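{- For every integer $n\geq 1$ the following identities hold: \begin{gather*} 3x\bigl(B_{n}(x)-B_{n-1}(x)\bigr)=C_{2n-1}(x)-(36x^2-6x-2)\sum_{k=1}^{n-1}B_k(x)C_{2(n-k)-1}(x),\\ B_{n}(x)-(18x^2-1)B_{n-1}(x)=C_{2(n-1)}(x)-(36x^2-6x-2)\sum_{k=1}^{n-1}B_k(x)C_{2(n-k-1)}(x),\\ B_{2n+1}(x)-3xB_{2n-1}(x)=C_{n}(x)+C_{n-1}(x)+(36x^2-6x-2)\sum_{k=0}^{n-1}B_{2k+1}(x)C_{n-k-1}(x),\\ B_{2n}(x)-3xB_{2(n-1)}(x)=6xC_{n-1}(x)+(36x^2-6x-2)\sum_{k=1}^{n-1}B_{2k}(x)C_{n-k-1}(x). \end{gather*}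
   Context: The balancing polynomials $B_n(x)$ and Lucas-balancing polynomials $C_n(x)$, $n\geq 0$, are defined by the recurrence $u_n(x)=6xu_{n-1}(x)-u_{n-2}(x)$ for $n\geq 2$, with initial terms $B_0(x)=0$, $B_1(x)=1$ and $C_0(x)=1$, $C_1(x)=3x$. Empty sums are equal to $0$. -}

module Defs where

open import Level using (Level)
open import Data.Nat using (ℕ; zero; suc; _∸_)
open import Algebra.Bundles using (CommutativeRing)

-- Polynomials in x are represented by evaluation at an arbitrary element x
-- of an arbitrary commutative ring R.  Taking R = ℤ[X] and x = X recovers
-- the polynomials themselves, so identities for all R, x are exactly
-- polynomial identities.
module _ {c ℓ : Level} (R : CommutativeRing c ℓ) where
  open CommutativeRing R

  nat : ℕ → Carrier
  nat zero    = 0#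
  nat (suc n) = 1# + nat n

  B : ℕ → Carrier → Carrier
  B zero          x = 0#
  B (suc zero)    x = 1#
  B (suc (suc n)) x = nat 6 * x * B (suc n) x - B n x

  C : ℕ → Carrier → Carrier
  C zero          x = 1#
  C (suc zero)    x = nat 3 * x
  C (suc (suc n)) x = nat 6 * x * C (suc n) x - C n x

  sumFrom : ℕ → ℕ → (ℕ → Carrier) → Carrier
  sumFrom a zero    f = 0#
  sumFrom a (suc m) f = f a + sumFrom (suc a) m f

  -- Σ a b f = Σ_{k=a}^{b} f k  (empty, i.e. 0#, when b < a)
  Σ : ℕ → ℕ → (ℕ → Carrier) → Carrier
  Σ a b f = sumFrom a (suc b ∸ a) f

-- As sequences in n, both sides of each identity satisfy one three-term recurrence
-- uₙ₊₂ = p uₙ₊₁ − uₙ: p = 6x for the first two identities and p = (6x)² − 2, the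
-- recurrence of the bisections B₂ₙ₊ᵣ and C₂ₙ₊ᵣ, for the last two. A convolution S of a
-- p-recurrent sequence satisfies the p-recurrence up to a forcing term w, and then
-- w + L·S is p-recurrent whenever w is (p − L)-recurrent. Here L = ±(36x² − 6x − 2) is
-- exactly the difference of the two parameters (6x)² − 2 and 6x, so the identities follow
-- from their first two instances.
module Submission where

open import Level using (Level)
open import Function using (_∘_)
open import Data.Nat as ℕ using (ℕ; zero; suc; _≤_; _∸_; z≤n; s≤s) renaming (_*_ to _*ℕ_; _+_ to _+ℕ_)
import Data.Nat.Properties as ℕ
open import Data.Nat.Tactic.RingSolver using (solve-∀)
open import Data.Integer as ℤ using (ℤ; +_; -[1+_]; _⊖_)
import Data.Integer.Properties as ℤ
open import Data.Sign as Sign using ()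
open import Data.Maybe using (Maybe; just; nothing)
open import Data.Product using (_×_; _,_; proj₁)
open import Relation.Nullary using (yes; no)
open import Relation.Binary.PropositionalEquality as ≡ using (_≡_; cong)
open import Algebra.Bundles using (CommutativeRing)
import Algebra.Solver.Ring.AlmostCommutativeRing as ACR
open import Defs

module IntegerCoefficients {c ℓ : Level} (R : CommutativeRing c ℓ) where
  open CommutativeRing R
  open import Algebra.Properties.Ring ring
  open import Algebra.Properties.Semiring.Mult semiring using (×-homo-+; ×1-homo-*) renaming (_×_ to _·_)
  open import Relation.Binary.Reasoning.Setoid setoid

  fromℤ : ℤ → Carrier
  fromℤ (+ n)    = n · 1#
  fromℤ -[1+ n ] = - (suc n · 1#)

  fromℤ-⊖ : ∀ m n → fromℤ (m ⊖ n) ≈ m · 1# - n · 1#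
  fromℤ-⊖ m       zero    = sym (trans (+-congˡ -0#≈0#) (+-identityʳ _))
  fromℤ-⊖ zero    (suc n) = sym (+-identityˡ _)
  fromℤ-⊖ (suc m) (suc n) rewrite ℤ.[1+m]⊖[1+n]≡m⊖n m n = begin
    fromℤ (m ⊖ n)                        ≈⟨ fromℤ-⊖ m n ⟩
    a - b                                ≈⟨ +-identityˡ (a - b) ⟨
    0# + (a - b)                         ≈⟨ +-congʳ (-‿inverseʳ 1#) ⟨
    (1# - 1#) + (a - b)                  ≈⟨ +-assoc 1# (- 1#) (a - b) ⟩
    1# + (- 1# + (a - b))                ≈⟨ +-congˡ (+-assoc (- 1#) a (- b)) ⟨
    1# + ((- 1# + a) - b)                ≈⟨ +-congˡ (+-congʳ (+-comm (- 1#) a)) ⟩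
    1# + ((a - 1#) - b)                  ≈⟨ +-congˡ (+-assoc a (- 1#) (- b)) ⟩
    1# + (a + (- 1# - b))                ≈⟨ +-assoc 1# a (- 1# - b) ⟨
    (1# + a) + (- 1# - b)                ≈⟨ +-congˡ (-‿+-comm 1# b) ⟩
    (1# + a) - (1# + b)                  ∎
    where a = m · 1#; b = n · 1#

  fromℤ-+ : ∀ i j → fromℤ (i ℤ.+ j) ≈ fromℤ i + fromℤ j
  fromℤ-+ (+ m)    (+ n)    = ×-homo-+ 1# m n
  fromℤ-+ (+ m)    -[1+ n ] = fromℤ-⊖ m (suc n)
  fromℤ-+ -[1+ m ] (+ n)    = trans (fromℤ-⊖ n (suc m)) (+-comm _ _)
  fromℤ-+ -[1+ m ] -[1+ n ] = begin
    - (suc (suc (m ℕ.+ n)) · 1#)          ≡⟨ cong (λ k → - (suc k · 1#)) (ℕ.+-suc m n) ⟨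
    - ((suc m ℕ.+ suc n) · 1#)           ≈⟨ -‿cong (×-homo-+ 1# (suc m) (suc n)) ⟩
    - (suc m · 1# + suc n · 1#)          ≈⟨ -‿+-comm _ _ ⟨
    - (suc m · 1#) - suc n · 1#          ∎

  fromℤ-◃⁺ : ∀ n → fromℤ (Sign.+ ℤ.◃ n) ≈ n · 1#
  fromℤ-◃⁺ zero    = refl
  fromℤ-◃⁺ (suc n) = refl

  fromℤ-◃⁻ : ∀ n → fromℤ (Sign.- ℤ.◃ n) ≈ - (n · 1#)
  fromℤ-◃⁻ zero    = sym -0#≈0#
  fromℤ-◃⁻ (suc n) = refl

  -‿*-cancel : ∀ x y → - x * - y ≈ x * y
  -‿*-cancel x y = begin
    - x * - y     ≈⟨ -‿distribˡ-* x (- y) ⟨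
    - (x * - y)   ≈⟨ -‿cong (-‿distribʳ-* x y) ⟨
    - - (x * y)   ≈⟨ -‿involutive (x * y) ⟩
    x * y         ∎

  fromℤ-* : ∀ i j → fromℤ (i ℤ.* j) ≈ fromℤ i * fromℤ j
  fromℤ-* (+ m)    (+ n)    = trans (fromℤ-◃⁺ (m ℕ.* n)) (×1-homo-* m n)
  fromℤ-* (+ m)    -[1+ n ] = trans (fromℤ-◃⁻ (m ℕ.* suc n))
    (trans (-‿cong (×1-homo-* m (suc n))) (-‿distribʳ-* _ _))
  fromℤ-* -[1+ m ] (+ n)    = trans (fromℤ-◃⁻ (suc m ℕ.* n))
    (trans (-‿cong (×1-homo-* (suc m) n)) (-‿distribˡ-* _ _))
  fromℤ-* -[1+ m ] -[1+ n ] = trans (×1-homo-* (suc m) (suc n)) (sym (-‿*-cancel _ _))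

  fromℤ-neg : ∀ i → fromℤ (ℤ.- i) ≈ - fromℤ i
  fromℤ-neg (+ zero)  = sym -0#≈0#
  fromℤ-neg (+ suc n) = refl
  fromℤ-neg -[1+ n ]  = sym (-‿involutive _)

  -- The solver compares syntax only up to evaluation, so the constant 1 must denote 1# itself
  -- (not 1 · 1# = 1# + 0#) for B₁ = 1# to be matched.
  coefficient : ℤ → Carrier
  coefficient (+ 1) = 1#
  coefficient i     = fromℤ i

  coefficient≈fromℤ : ∀ i → coefficient i ≈ fromℤ i
  coefficient≈fromℤ (+ 0)           = refl
  coefficient≈fromℤ (+ 1)           = sym (+-identityʳ 1#)
  coefficient≈fromℤ (+ suc (suc n)) = refl
  coefficient≈fromℤ -[1+ n ]        = refl

  coefficient-homomorphism : ℤ.+-*-rawRing ACR.-Raw-AlmostCommutative⟶ ACR.fromCommutativeRing R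
  coefficient-homomorphism = record
    { ⟦_⟧    = coefficient
    ; +-homo = λ i j → via (i ℤ.+ j) (fromℤ-+ i j) (+-cong (coefficient≈fromℤ i) (coefficient≈fromℤ j))
    ; *-homo = λ i j → via (i ℤ.* j) (fromℤ-* i j) (*-cong (coefficient≈fromℤ i) (coefficient≈fromℤ j))
    ; -‿homo = λ i → via (ℤ.- i) (fromℤ-neg i) (-‿cong (coefficient≈fromℤ i))
    ; 0-homo = refl
    ; 1-homo = refl
    }
    where
    via : ∀ i {a b} → fromℤ i ≈ a → b ≈ a → coefficient i ≈ b
    via i i≈a b≈a = trans (coefficient≈fromℤ i) (trans i≈a (sym b≈a))

  coefficient-≟ : ∀ i j → Maybe (coefficient i ≈ coefficient j)
  coefficient-≟ i j with i ℤ.≟ j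
  ... | yes ≡.refl = just refl
  ... | no _       = nothing

  open import Algebra.Solver.Ring ℤ.+-*-rawRing (ACR.fromCommutativeRing R)
    coefficient-homomorphism coefficient-≟ public

module Recurrences {c ℓ : Level} (R : CommutativeRing c ℓ) where
  open CommutativeRing R
  open IntegerCoefficients R
  open import Relation.Binary.Reasoning.Setoid setoid

  Recurrent : Carrier → (ℕ → Carrier) → Set ℓ
  Recurrent p u = ∀ n → u (suc (suc n)) ≈ p * u (suc n) - u n

  InhomRecurrent : Carrier → (ℕ → Carrier) → (ℕ → Carrier) → Set ℓ
  InhomRecurrent p w s = ∀ n → s (suc (suc n)) ≈ p * s (suc n) - s n + w (suc n)

  recurrent-unique : ∀ {p u v} → Recurrent p u → Recurrent p v →
                     u 0 ≈ v 0 → u 1 ≈ v 1 → ∀ n → u n ≈ v n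
  recurrent-unique {p} {u} {v} ru rv u₀≈v₀ u₁≈v₁ n = proj₁ (consecutive n)
    where
    consecutive : ∀ n → u n ≈ v n × u (suc n) ≈ v (suc n)
    consecutive zero    = u₀≈v₀ , u₁≈v₁
    consecutive (suc n) with consecutive n
    ... | uₙ≈vₙ , uₙ₊₁≈vₙ₊₁ = uₙ₊₁≈vₙ₊₁ , (begin
      u (2 +ℕ n)             ≈⟨ ru n ⟩
      p * u (suc n) - u n    ≈⟨ +-cong (*-congˡ uₙ₊₁≈vₙ₊₁) (-‿cong uₙ≈vₙ) ⟩
      p * v (suc n) - v n    ≈⟨ rv n ⟨
      v (2 +ℕ n)             ∎)

  recurrent-suc : ∀ {p u} → Recurrent p u → Recurrent p (u ∘ suc)
  recurrent-suc ru = ru ∘ suc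

  recurrent-+ : ∀ {p u v} → Recurrent p u → Recurrent p v → Recurrent p (λ n → u n + v n)
  recurrent-+ {p} {u} {v} ru rv n = trans (+-cong (ru n) (rv n))
    (solve 5 (λ p u₀ u₁ v₀ v₁ → p :* u₁ :- u₀ :+ (p :* v₁ :- v₀) := p :* (u₁ :+ v₁) :- (u₀ :+ v₀))
       refl p (u n) (u (suc n)) (v n) (v (suc n)))

  recurrent-− : ∀ {p u v} → Recurrent p u → Recurrent p v → Recurrent p (λ n → u n - v n)
  recurrent-− {p} {u} {v} ru rv n = trans (+-cong (ru n) (-‿cong (rv n)))
    (solve 5 (λ p u₀ u₁ v₀ v₁ → p :* u₁ :- u₀ :- (p :* v₁ :- v₀) := p :* (u₁ :- v₁) :- (u₀ :- v₀))
       refl p (u n) (u (suc n)) (v n) (v (suc n)))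

  recurrent-*ˡ : ∀ {p u} α → Recurrent p u → Recurrent p (λ n → α * u n)
  recurrent-*ˡ {p} {u} α ru n = trans (*-congˡ (ru n))
    (solve 4 (λ α p u₀ u₁ → α :* (p :* u₁ :- u₀) := p :* (α :* u₁) :- α :* u₀)
       refl α p (u n) (u (suc n)))

  recurrent-skip : ∀ {p u} → Recurrent p u → ∀ n →
                   u (4 +ℕ n) ≈ (p * p - nat R 2) * u (2 +ℕ n) - u n
  recurrent-skip {p} {u} ru n = begin
    u (4 +ℕ n)
      ≈⟨ ru (2 +ℕ n) ⟩
    p * u (3 +ℕ n) - u₂
      ≈⟨ +-congʳ (*-congˡ (ru (suc n))) ⟩
    p * (p * u₂ - u₁) - u₂
      ≈⟨ solve 3 (λ p u₁ u₂ → p :* (p :* u₂ :- u₁) :- u₂ := (p :* p :- con (+ 2)) :* u₂ :- (p :* u₁ :- u₂))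
           refl p u₁ u₂ ⟩
    (p * p - nat R 2) * u₂ - (p * u₁ - u₂)
      ≈⟨ +-congˡ (-‿cong (+-congˡ (-‿cong (ru n)))) ⟩
    (p * p - nat R 2) * u₂ - (p * u₁ - (p * u₁ - u n))
      ≈⟨ +-congˡ (-‿cong (solve 2 (λ a b → a :- (a :- b) := b) refl (p * u₁) (u n))) ⟩
    (p * p - nat R 2) * u₂ - u n ∎
    where u₁ = u (suc n); u₂ = u (2 +ℕ n)

  recurrent-bisect : ∀ {p u} → Recurrent p u → ∀ r →
                     Recurrent (p * p - nat R 2) (λ k → u (r +ℕ 2 *ℕ k))
  recurrent-bisect {p} {u} ru r k = begin
    u (r +ℕ 2 *ℕ (2 +ℕ k))
      ≡⟨ cong u (≡.trans (cong (2 +ℕ_) (step r k)) (step r (suc k))) ⟨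
    u (4 +ℕ (r +ℕ 2 *ℕ k))
      ≈⟨ recurrent-skip ru (r +ℕ 2 *ℕ k) ⟩
    (p * p - nat R 2) * u (2 +ℕ (r +ℕ 2 *ℕ k)) - u (r +ℕ 2 *ℕ k)
      ≡⟨ cong (λ i → (p * p - nat R 2) * u i - u (r +ℕ 2 *ℕ k)) (step r k) ⟩
    (p * p - nat R 2) * u (r +ℕ 2 *ℕ suc k) - u (r +ℕ 2 *ℕ k) ∎
    where
    step : ∀ r k → 2 +ℕ (r +ℕ 2 *ℕ k) ≡ r +ℕ 2 *ℕ suc k
    step = solve-∀

  conv : (ℕ → Carrier) → (ℕ → Carrier) → ℕ → Carrier
  conv f g zero    = f 0 * g 0
  conv f g (suc n) = f 0 * g (suc n) + conv (f ∘ suc) g n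

  conv-congˡ : ∀ {f f′} g → (∀ k → f k ≈ f′ k) → ∀ n → conv f g n ≈ conv f′ g n
  conv-congˡ g f≈f′ zero    = *-congʳ (f≈f′ 0)
  conv-congˡ g f≈f′ (suc n) = +-cong (*-congʳ (f≈f′ 0)) (conv-congˡ g (f≈f′ ∘ suc) n)

  conv-linearˡ : ∀ p f h g n → conv (λ k → p * f k - h k) g n ≈ p * conv f g n - conv h g n
  conv-linearˡ p f h g zero    = solve 4 (λ p f h g → (p :* f :- h) :* g := p :* (f :* g) :- h :* g)
                                   refl p (f 0) (h 0) (g 0)
  conv-linearˡ p f h g (suc n) = begin
    (p * f 0 - h 0) * g (suc n) + conv (λ k → p * f (suc k) - h (suc k)) g n
      ≈⟨ +-congˡ (conv-linearˡ p (f ∘ suc) (h ∘ suc) g n) ⟩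
    (p * f 0 - h 0) * g (suc n) + (p * conv (f ∘ suc) g n - conv (h ∘ suc) g n)
      ≈⟨ solve 6 (λ p f h g F H → (p :* f :- h) :* g :+ (p :* F :- H) := p :* (f :* g :+ F) :- (h :* g :+ H))
           refl p (f 0) (h 0) (g (suc n)) (conv (f ∘ suc) g n) (conv (h ∘ suc) g n) ⟩
    p * conv f g (suc n) - conv h g (suc n) ∎

  convForcing : Carrier → (ℕ → Carrier) → (ℕ → Carrier) → ℕ → Carrier
  convForcing p f g n = f 0 * g (suc n) + (f 1 - p * f 0) * g n

  conv-inhomRecurrent : ∀ {p f} g → Recurrent p f → InhomRecurrent p (convForcing p f g) (conv f g)
  conv-inhomRecurrent {p} {f} g rf n = begin
    f 0 * g (2 +ℕ n) + (f 1 * g (suc n) + conv (f ∘ suc ∘ suc) g n)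
      ≈⟨ +-congˡ (+-congˡ (conv-congˡ g rf n)) ⟩
    f 0 * g (2 +ℕ n) + (f 1 * g (suc n) + conv (λ k → p * f (suc k) - f k) g n)
      ≈⟨ +-congˡ (+-congˡ (conv-linearˡ p (f ∘ suc) f g n)) ⟩
    f 0 * g (2 +ℕ n) + (f 1 * g (suc n) + (p * conv (f ∘ suc) g n - conv f g n))
      ≈⟨ solve 7 (λ p f₀ f₁ g₁ g₂ F′ F → f₀ :* g₂ :+ (f₁ :* g₁ :+ (p :* F′ :- F))
                   := p :* (f₀ :* g₁ :+ F′) :- F :+ (f₀ :* g₂ :+ (f₁ :- p :* f₀) :* g₁))
           refl p (f 0) (f 1) (g (suc n)) (g (2 +ℕ n)) (conv (f ∘ suc) g n) (conv f g n) ⟩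
    p * conv f g (suc n) - conv f g n + (f 0 * g (2 +ℕ n) + (f 1 - p * f 0) * g (suc n)) ∎

  inhomRecurrent-cong : ∀ {p w w′ s} → (∀ n → w n ≈ w′ n) → InhomRecurrent p w s → InhomRecurrent p w′ s
  inhomRecurrent-cong w≈w′ rs n = trans (rs n) (+-congˡ (w≈w′ (suc n)))

  inhomRecurrent⇒recurrent : ∀ {p q L w s} → Recurrent q w → q + L ≈ p → InhomRecurrent p w s →
                             Recurrent p (λ n → w n + L * s n)
  inhomRecurrent⇒recurrent {p} {q} {L} {w} {s} rw q+L≈p rs n = begin
    w (2 +ℕ n) + L * s (2 +ℕ n)                          ≈⟨ +-cong (rw n) (*-congˡ (rs n)) ⟩
    q * w₁ - w n + L * (p * s₁ - s n + w₁)               ≈⟨ solve 7 (λ p q L w₀ w₁ s₀ s₁ →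
                                                              q :* w₁ :- w₀ :+ L :* (p :* s₁ :- s₀ :+ w₁)
                                                              := (q :+ L) :* w₁ :- w₀ :+ L :* (p :* s₁ :- s₀))
                                                            refl p q L (w n) w₁ (s n) s₁ ⟩
    (q + L) * w₁ - w n + L * (p * s₁ - s n)              ≈⟨ +-congʳ (+-congʳ (*-congʳ q+L≈p)) ⟩
    p * w₁ - w n + L * (p * s₁ - s n)                    ≈⟨ solve 6 (λ p L w₀ w₁ s₀ s₁ →
                                                              p :* w₁ :- w₀ :+ L :* (p :* s₁ :- s₀)
                                                              := p :* (w₁ :+ L :* s₁) :- (w₀ :+ L :* s₀))
                                                            refl p L (w n) w₁ (s n) s₁ ⟩
    p * (w₁ + L * s₁) - (w n + L * s n)                  ∎
    where w₁ = w (suc n); s₁ = s (suc n)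

  sumFrom-shift : ∀ a m F → sumFrom R (suc a) m F ≡ sumFrom R a m (F ∘ suc)
  sumFrom-shift a zero    F = ≡.refl
  sumFrom-shift a (suc m) F = cong (λ t → F (suc a) + t) (sumFrom-shift (suc a) m F)

  Σ₀-conv : ∀ m F f g → (∀ k → k ≤ m → F k ≈ f k * g (m ∸ k)) → Σ R 0 m F ≈ conv f g m
  Σ₀-conv zero    F f g F≈ = trans (+-identityʳ (F 0)) (F≈ 0 z≤n)
  Σ₀-conv (suc m) F f g F≈ = +-cong (F≈ 0 z≤n) (begin
    sumFrom R 1 (suc m) F           ≡⟨ sumFrom-shift 0 (suc m) F ⟩
    sumFrom R 0 (suc m) (F ∘ suc)   ≈⟨ Σ₀-conv m (F ∘ suc) (f ∘ suc) g
                                         (λ k k≤m → F≈ (suc k) (s≤s k≤m)) ⟩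
    conv (f ∘ suc) g m              ∎)

  Σ₁-conv : ∀ m F f g → f 0 ≈ 0# → (∀ k → 1 ≤ k → k ≤ m → F k ≈ f k * g (m ∸ k)) →
            Σ R 1 m F ≈ conv f g m
  Σ₁-conv zero    F f g f₀≈0 F≈ = sym (trans (*-congʳ f₀≈0) (zeroˡ (g 0)))
  Σ₁-conv (suc m) F f g f₀≈0 F≈ = begin
    sumFrom R 1 (suc m) F                 ≡⟨ sumFrom-shift 0 (suc m) F ⟩
    sumFrom R 0 (suc m) (F ∘ suc)         ≈⟨ Σ₀-conv m (F ∘ suc) (f ∘ suc) g
                                               (λ k k≤m → F≈ (suc k) (s≤s z≤n) (s≤s k≤m)) ⟩
    conv (f ∘ suc) g m                    ≈⟨ +-identityˡ _ ⟨
    0# + conv (f ∘ suc) g m               ≈⟨ +-congʳ (trans (*-congʳ f₀≈0) (zeroˡ _)) ⟨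
    f 0 * g (suc m) + conv (f ∘ suc) g m  ∎

module Balancing {a ℓ : Level} (R : CommutativeRing a ℓ) (x : CommutativeRing.Carrier R) where
  open CommutativeRing R
  open import Algebra.Properties.Ring ring using (-‿distribˡ-*)
  open IntegerCoefficients R
  open Recurrences R

  b c : ℕ → Carrier
  b n = B R n x
  c n = C R n x

  y D K : Carrier
  y = nat R 6 * x
  D = y * y - nat R 2
  K = nat R 36 * x * x - nat R 6 * x - nat R 2

  yᵖ Dᵖ Kᵖ : ∀ {k} → Polynomial k → Polynomial k
  yᵖ X = con (+ 6) :* X
  Dᵖ X = yᵖ X :* yᵖ X :- con (+ 2)
  Kᵖ X = con (+ 36) :* X :* X :- con (+ 6) :* X :- con (+ 2)

  Bᵖ Cᵖ : ∀ {k} → ℕ → Polynomial k → Polynomial k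
  Bᵖ zero          X = con (+ 0)
  Bᵖ (suc zero)    X = con (+ 1)
  Bᵖ (suc (suc n)) X = yᵖ X :* Bᵖ (suc n) X :- Bᵖ n X
  Cᵖ zero          X = con (+ 1)
  Cᵖ (suc zero)    X = con (+ 3) :* X
  Cᵖ (suc (suc n)) X = yᵖ X :* Cᵖ (suc n) X :- Cᵖ n X

  D-K≈y : D - K ≈ y
  D-K≈y = solve 1 (λ X → Dᵖ X :- Kᵖ X := yᵖ X) refl x

  y+K≈D : y + K ≈ D
  y+K≈D = solve 1 (λ X → yᵖ X :+ Kᵖ X := Dᵖ X) refl x

  rb : Recurrent y b
  rb n = refl

  rc : Recurrent y c
  rc n = refl

  bₒ bₑ cₒ cₑ : ℕ → Carrier
  bₒ k = b (1 +ℕ 2 *ℕ k)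
  bₑ k = b (2 *ℕ k)
  cₒ k = c (1 +ℕ 2 *ℕ k)
  cₑ k = c (2 *ℕ k)

  rbₒ : Recurrent D bₒ
  rbₒ = recurrent-bisect rb 1

  rbₑ : Recurrent D bₑ
  rbₑ = recurrent-bisect rb 0

  rcₒ : Recurrent D cₒ
  rcₒ = recurrent-bisect rc 1

  rcₑ : Recurrent D cₑ
  rcₑ = recurrent-bisect rc 0

  b-forcing : ∀ g n → convForcing y b g n ≈ g n
  b-forcing g n = solve 3 (λ X g₀ g₁ → Bᵖ 0 X :* g₁ :+ (Bᵖ 1 X :- yᵖ X :* Bᵖ 0 X) :* g₀ := g₀)
                    refl x (g n) (g (suc n))

  bₒ-forcing : ∀ g n → convForcing D bₒ g n ≈ g (suc n) + g n
  bₒ-forcing g n = solve 3 (λ X g₀ g₁ → Bᵖ 1 X :* g₁ :+ (Bᵖ 3 X :- Dᵖ X :* Bᵖ 1 X) :* g₀ := g₁ :+ g₀)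
                     refl x (g n) (g (suc n))

  bₑ-forcing : ∀ g n → convForcing D bₑ g n ≈ y * g n
  bₑ-forcing g n = solve 3 (λ X g₀ g₁ → Bᵖ 0 X :* g₁ :+ (Bᵖ 2 X :- Dᵖ X :* Bᵖ 0 X) :* g₀ := yᵖ X :* g₀)
                     refl x (g n) (g (suc n))

  identity₁ : ∀ m → nat R 3 * x * (b (suc m) - b m) ≈ cₒ m - K * conv b cₒ m
  identity₁ m = trans (recurrent-unique lhs rhs base₀ base₁ m) (+-congˡ (sym (-‿distribˡ-* K _)))
    where
    lhs : Recurrent y (λ m → nat R 3 * x * (b (suc m) - b m))
    lhs = recurrent-*ˡ (nat R 3 * x) (recurrent-− (recurrent-suc rb) rb)
    rhs : Recurrent y (λ m → cₒ m + - K * conv b cₒ m)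
    rhs = inhomRecurrent⇒recurrent rcₒ D-K≈y
            (inhomRecurrent-cong (b-forcing cₒ) (conv-inhomRecurrent cₒ rb))
    base₀ : nat R 3 * x * (b 1 - b 0) ≈ cₒ 0 + - K * conv b cₒ 0
    base₀ = solve 1 (λ X → con (+ 3) :* X :* (Bᵖ 1 X :- Bᵖ 0 X)
                           := Cᵖ 1 X :+ (:- Kᵖ X) :* (Bᵖ 0 X :* Cᵖ 1 X)) refl x
    base₁ : nat R 3 * x * (b 2 - b 1) ≈ cₒ 1 + - K * conv b cₒ 1
    base₁ = solve 1 (λ X → con (+ 3) :* X :* (Bᵖ 2 X :- Bᵖ 1 X)
                           := Cᵖ 3 X :+ (:- Kᵖ X) :* (Bᵖ 0 X :* Cᵖ 3 X :+ Bᵖ 1 X :* Cᵖ 1 X)) refl x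

  identity₂ : ∀ m → b (suc m) - (nat R 18 * x * x - 1#) * b m ≈ cₑ m - K * conv b cₑ m
  identity₂ m = trans (recurrent-unique lhs rhs base₀ base₁ m) (+-congˡ (sym (-‿distribˡ-* K _)))
    where
    lhs : Recurrent y (λ m → b (suc m) - (nat R 18 * x * x - 1#) * b m)
    lhs = recurrent-− (recurrent-suc rb) (recurrent-*ˡ (nat R 18 * x * x - 1#) rb)
    rhs : Recurrent y (λ m → cₑ m + - K * conv b cₑ m)
    rhs = inhomRecurrent⇒recurrent rcₑ D-K≈y
            (inhomRecurrent-cong (b-forcing cₑ) (conv-inhomRecurrent cₑ rb))
    base₀ : b 1 - (nat R 18 * x * x - 1#) * b 0 ≈ cₑ 0 + - K * conv b cₑ 0
    base₀ = solve 1 (λ X → Bᵖ 1 X :- (con (+ 18) :* X :* X :- con (+ 1)) :* Bᵖ 0 X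
                           := Cᵖ 0 X :+ (:- Kᵖ X) :* (Bᵖ 0 X :* Cᵖ 0 X)) refl x
    base₁ : b 2 - (nat R 18 * x * x - 1#) * b 1 ≈ cₑ 1 + - K * conv b cₑ 1
    base₁ = solve 1 (λ X → Bᵖ 2 X :- (con (+ 18) :* X :* X :- con (+ 1)) :* Bᵖ 1 X
                           := Cᵖ 2 X :+ (:- Kᵖ X) :* (Bᵖ 0 X :* Cᵖ 2 X :+ Bᵖ 1 X :* Cᵖ 0 X)) refl x

  identity₃ : ∀ m → bₒ (suc m) - nat R 3 * x * bₒ m ≈ c (suc m) + c m + K * conv bₒ c m
  identity₃ = recurrent-unique lhs rhs base₀ base₁
    where
    lhs : Recurrent D (λ m → bₒ (suc m) - nat R 3 * x * bₒ m)
    lhs = recurrent-− (recurrent-suc rbₒ) (recurrent-*ˡ (nat R 3 * x) rbₒ)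
    rhs : Recurrent D (λ m → c (suc m) + c m + K * conv bₒ c m)
    rhs = inhomRecurrent⇒recurrent (recurrent-+ (recurrent-suc rc) rc) y+K≈D
            (inhomRecurrent-cong (bₒ-forcing c) (conv-inhomRecurrent c rbₒ))
    base₀ : bₒ 1 - nat R 3 * x * bₒ 0 ≈ c 1 + c 0 + K * conv bₒ c 0
    base₀ = solve 1 (λ X → Bᵖ 3 X :- con (+ 3) :* X :* Bᵖ 1 X
                           := Cᵖ 1 X :+ Cᵖ 0 X :+ Kᵖ X :* (Bᵖ 1 X :* Cᵖ 0 X)) refl x
    base₁ : bₒ 2 - nat R 3 * x * bₒ 1 ≈ c 2 + c 1 + K * conv bₒ c 1
    base₁ = solve 1 (λ X → Bᵖ 5 X :- con (+ 3) :* X :* Bᵖ 3 X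
                           := Cᵖ 2 X :+ Cᵖ 1 X :+ Kᵖ X :* (Bᵖ 1 X :* Cᵖ 1 X :+ Bᵖ 3 X :* Cᵖ 0 X)) refl x

  identity₄ : ∀ m → bₑ (suc m) - nat R 3 * x * bₑ m ≈ y * c m + K * conv bₑ c m
  identity₄ = recurrent-unique lhs rhs base₀ base₁
    where
    lhs : Recurrent D (λ m → bₑ (suc m) - nat R 3 * x * bₑ m)
    lhs = recurrent-− (recurrent-suc rbₑ) (recurrent-*ˡ (nat R 3 * x) rbₑ)
    rhs : Recurrent D (λ m → y * c m + K * conv bₑ c m)
    rhs = inhomRecurrent⇒recurrent (recurrent-*ˡ y rc) y+K≈D
            (inhomRecurrent-cong (bₑ-forcing c) (conv-inhomRecurrent c rbₑ))
    base₀ : bₑ 1 - nat R 3 * x * bₑ 0 ≈ y * c 0 + K * conv bₑ c 0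
    base₀ = solve 1 (λ X → Bᵖ 2 X :- con (+ 3) :* X :* Bᵖ 0 X
                           := yᵖ X :* Cᵖ 0 X :+ Kᵖ X :* (Bᵖ 0 X :* Cᵖ 0 X)) refl x
    base₁ : bₑ 2 - nat R 3 * x * bₑ 1 ≈ y * c 1 + K * conv bₑ c 1
    base₁ = solve 1 (λ X → Bᵖ 4 X :- con (+ 3) :* X :* Bᵖ 2 X
                           := yᵖ X :* Cᵖ 1 X :+ Kᵖ X :* (Bᵖ 0 X :* Cᵖ 1 X :+ Bᵖ 2 X :* Cᵖ 0 X)) refl x

2*[1+m]∸1≡1+2*m : ∀ m → 2 *ℕ suc m ∸ 1 ≡ 1 +ℕ 2 *ℕ m
2*[1+m]∸1≡1+2*m m = cong (_∸ 1) (ℕ.*-suc 2 m)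

[1+m]∸k∸1≡m∸k : ∀ {k m} → k ≤ m → suc m ∸ k ∸ 1 ≡ m ∸ k
[1+m]∸k∸1≡m∸k k≤m = cong (_∸ 1) (ℕ.+-∸-assoc 1 k≤m)

theorem3 : {c ℓ : Level} (R : CommutativeRing c ℓ) (x : CommutativeRing.Carrier R) (n : ℕ) → 1 ≤ n →
  let open CommutativeRing R
      K = nat R 36 * x * x - nat R 6 * x - nat R 2
      b = λ m → B R m x
      cc = λ m → C R m x
  in (nat R 3 * x * (b n - b (n ∸ 1))
        ≈ cc (2 *ℕ n ∸ 1) - K * Σ R 1 (n ∸ 1) (λ k → b k * cc (2 *ℕ (n ∸ k) ∸ 1)))
   × (b n - (nat R 18 * x * x - 1#) * b (n ∸ 1)
        ≈ cc (2 *ℕ (n ∸ 1)) - K * Σ R 1 (n ∸ 1) (λ k → b k * cc (2 *ℕ (n ∸ k ∸ 1))))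
   × (b (2 *ℕ n +ℕ 1) - nat R 3 * x * b (2 *ℕ n ∸ 1)
        ≈ cc n + cc (n ∸ 1) + K * Σ R 0 (n ∸ 1) (λ k → b (2 *ℕ k +ℕ 1) * cc (n ∸ k ∸ 1)))
   × (b (2 *ℕ n) - nat R 3 * x * b (2 *ℕ (n ∸ 1))
        ≈ nat R 6 * x * cc (n ∸ 1) + K * Σ R 1 (n ∸ 1) (λ k → b (2 *ℕ k) * cc (n ∸ k ∸ 1)))
theorem3 R x zero ()
theorem3 R x (suc m) _ =
    trans (identity₁ m) (+-cong (c-≡ (≡.sym (2*[1+m]∸1≡1+2*m m))) (-‿cong (*-congˡ (sym
      (Σ₁-conv m _ b cₒ refl λ k _ k≤m → *-congˡ (c-≡ (≡.trans
        (cong (λ t → 2 *ℕ t ∸ 1) (ℕ.+-∸-assoc 1 k≤m)) (2*[1+m]∸1≡1+2*m (m ∸ k)))))))))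
  , trans (identity₂ m) (+-congˡ (-‿cong (*-congˡ (sym
      (Σ₁-conv m _ b cₑ refl λ k _ k≤m → *-congˡ (c-≡ (cong (2 *ℕ_) ([1+m]∸k∸1≡m∸k k≤m))))))))
  , trans (+-cong (b-≡ (ℕ.+-comm (2 *ℕ suc m) 1)) (-‿cong (*-congˡ (b-≡ (2*[1+m]∸1≡1+2*m m)))))
      (trans (identity₃ m) (+-congˡ (*-congˡ (sym
        (Σ₀-conv m _ bₒ c λ k k≤m → *-cong (b-≡ (ℕ.+-comm (2 *ℕ k) 1)) (c-≡ ([1+m]∸k∸1≡m∸k k≤m)))))))
  , trans (identity₄ m) (+-congˡ (*-congˡ (sym
      (Σ₁-conv m _ bₑ c refl λ k _ k≤m → *-congˡ (c-≡ ([1+m]∸k∸1≡m∸k k≤m))))))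
  where
  open CommutativeRing R
  open Recurrences R
  open Balancing R x

  b-≡ : ∀ {i j} → i ≡ j → b i ≈ b j
  b-≡ = reflexive ∘ cong b

  c-≡ : ∀ {i j} → i ≡ j → c i ≈ c j
  c-≡ = reflexive ∘ cong c
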